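{- In any decorated theory for exceptions (as described in the context), for every propagator $g:X\to Y$ one has the strong equation $[\,g\,|\,[\,]_Y\,]\equiv g$, where $[\,g\,|\,[\,]_Y\,]:X\to Y$ is the catcher given by the decorated coproduct $X\cong X+\mathbb{0}$ applied to $g$ and to $[\,]_Y:\mathbb{0}\to Y$.
   Context: A decorated theory for exceptions consists of types and expressions $f:X\to Y$, each expression carrying a decoration: pure, propagator or catcher, where every pure expression is a propagator and every propagator is a catcher. Identities are pure; composites of pure (resp. propagator) expressions are pure (resp. propagators). There are two equivalence relations between parallel expressions: strong equations $\equiv$ and weak equations $\sim$. Composition is associative and unital up to $\equiv$; $f\equiv g$ implies $f\sim g$; if $f,g$ are propagators then $f\sim g$ implies $f\equiv g$; $\equiv$ is a congruence for composition; $f_1\sim f_2$ implies $g\circ f_1\sim g\circ f_2$ for every $g$, and $g_1\sim g_2$ implies $g_1\circ f\sim g_2\circ f$ when $f$ is pure. There is an empty type $\mathbb{0}$: for every type $X$ a pure expression $[\,]_X:\mathbb{0}\to X$ such that every expression $f:\mathbb{0}\to X$ satisfies $f\sim[\,]_X$. Decorated coproduct $X\cong X+\mathbb{0}$: for every propagator $g:X\to Y$ and every catcher $k:\mathbb{0}\to Y$ there is a catcher $[g|k]:X\to Y$ with $[g|k]\sim g$ and $[g|k]\circ[\,]_X\equiv k$, and any catcher $f:X\to Y$ with $f\sim g$ and $f\circ[\,]_X\equiv k$ satisfies $f\equiv[g|k]$. -}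

module Defs where

open import Level using (Level; _⊔_; suc)
open import Relation.Binary.Core using (Rel)
open import Relation.Binary.Structures using (IsEquivalence)

-- Expressions X → Y form a type `Hom X Y`; every expression is a catcher
-- (catcher is the most general decoration); the predicates `Ppg` and `Pure`
-- single out propagators and pure expressions.
record DecoratedTheory (o h p e : Level) : Set (suc (o ⊔ h ⊔ p ⊔ e)) where
  infixr 9 _∘_
  infix 4 _≡s_ _∼w_
  field
    Obj  : Set o
    Hom  : Obj → Obj → Set h
    Pure : ∀ {X Y} → Hom X Y → Set p
    Ppg  : ∀ {X Y} → Hom X Y → Set p
    pure⇒ppg : ∀ {X Y} {f : Hom X Y} → Pure f → Ppg f

    id  : ∀ {X} → Hom X X
    _∘_ : ∀ {X Y Z} → Hom Y Z → Hom X Y → Hom X Z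
    id-pure : ∀ {X} → Pure (id {X})
    ∘-pure : ∀ {X Y Z} {g : Hom Y Z} {f : Hom X Y} → Pure g → Pure f → Pure (g ∘ f)
    ∘-ppg  : ∀ {X Y Z} {g : Hom Y Z} {f : Hom X Y} → Ppg g → Ppg f → Ppg (g ∘ f)

    _≡s_ : ∀ {X Y} → Rel (Hom X Y) e
    _∼w_ : ∀ {X Y} → Rel (Hom X Y) e
    ≡s-equiv : ∀ {X Y} → IsEquivalence (_≡s_ {X} {Y})
    ∼w-equiv : ∀ {X Y} → IsEquivalence (_∼w_ {X} {Y})

    assoc : ∀ {W X Y Z} (h : Hom Y Z) (g : Hom X Y) (f : Hom W X) →
            (h ∘ g) ∘ f ≡s h ∘ (g ∘ f)
    identityˡ : ∀ {X Y} (f : Hom X Y) → id ∘ f ≡s f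
    identityʳ : ∀ {X Y} (f : Hom X Y) → f ∘ id ≡s f

    strong⇒weak : ∀ {X Y} {f g : Hom X Y} → f ≡s g → f ∼w g
    weak⇒strong-ppg : ∀ {X Y} {f g : Hom X Y} → Ppg f → Ppg g → f ∼w g → f ≡s g
    ∘-cong-≡s : ∀ {X Y Z} {g₁ g₂ : Hom Y Z} {f₁ f₂ : Hom X Y} →
                g₁ ≡s g₂ → f₁ ≡s f₂ → g₁ ∘ f₁ ≡s g₂ ∘ f₂
    ∘-congˡ-∼w : ∀ {X Y Z} (g : Hom Y Z) {f₁ f₂ : Hom X Y} →
                 f₁ ∼w f₂ → g ∘ f₁ ∼w g ∘ f₂
    ∘-congʳ-∼w : ∀ {X Y Z} {g₁ g₂ : Hom Y Z} (f : Hom X Y) → Pure f →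
                 g₁ ∼w g₂ → g₁ ∘ f ∼w g₂ ∘ f

    𝟘 : Obj
    [] : ∀ X → Hom 𝟘 X
    []-pure : ∀ {X} → Pure ([] X)
    []-weak-unique : ∀ {X} (f : Hom 𝟘 X) → f ∼w [] X

    -- decorated coproduct X ≅ X + 𝟘
    [_∣_] : ∀ {X Y} (g : Hom X Y) → Ppg g → Hom 𝟘 Y → Hom X Y
    copair-weak : ∀ {X Y} (g : Hom X Y) (pg : Ppg g) (k : Hom 𝟘 Y) →
                  [ g ∣ pg ] k ∼w g
    copair-strong : ∀ {X Y} (g : Hom X Y) (pg : Ppg g) (k : Hom 𝟘 Y) →
                    [ g ∣ pg ] k ∘ [] X ≡s k
    copair-unique : ∀ {X Y} (g : Hom X Y) (pg : Ppg g) (k : Hom 𝟘 Y)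
                    (f : Hom X Y) → f ∼w g → f ∘ [] X ≡s k → f ≡s [ g ∣ pg ] k

module Submission where

-- Idea: the copairing [ g ∣ [] Y ] is characterised up to ≡s by the universal
-- property of the decorated coproduct X ≅ X + 𝟘.  So it suffices to show that
-- g itself satisfies the two defining conditions with k = [] Y:
--   * g ∼w g, trivially;
--   * g ∘ [] X ≡s [] Y.  This is a statement about propagators out of 𝟘:
--     any two of them are weakly equal to [] (weak uniqueness of 𝟘), and
--     weak equality between propagators is strong.

open import Defs
open import Relation.Binary.Structures using (IsEquivalence)

module _ {o h p e} (T : DecoratedTheory o h p e) where
  open DecoratedTheory T

  ppg-from-𝟘-unique : ∀ {Y} (f : Hom 𝟘 Y) → Ppg f → f ≡s [] Y
  ppg-from-𝟘-unique {Y} f pf =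
    weak⇒strong-ppg pf (pure⇒ppg []-pure) ([]-weak-unique f)

  ppg-∘-[] : ∀ {X Y} (g : Hom X Y) → Ppg g → g ∘ [] X ≡s [] Y
  ppg-∘-[] {X} g pg = ppg-from-𝟘-unique (g ∘ [] X) (∘-ppg pg (pure⇒ppg []-pure))

lemma2 : ∀ {o h p e} (T : DecoratedTheory o h p e) →
    let open DecoratedTheory T in
    ∀ {X Y} (g : Hom X Y) (pg : Ppg g) → [ g ∣ pg ] ([] Y) ≡s g
lemma2 T {X} {Y} g pg =
  IsEquivalence.sym ≡s-equiv
    (copair-unique g pg ([] Y) g (IsEquivalence.refl ∼w-equiv) (ppg-∘-[] T g pg))
  where open DecoratedTheory T
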